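{- Let $G$ be a graph and $(u,v)\in V_p$. Then $r_w(u,v)=0$ for all $w\in V(G)\setminus\{u,v\}$ if and only if $V_i(u)\setminus\{v\}=V_i(v)\setminus\{u\}$ for every $1\leq i\leq\mathrm{diam}(G)$.
   Context: All graphs are finite, simple, connected and have at least two vertices; $d(x,y)$ is the shortest-path distance and $\mathrm{diam}(G)$ the maximum distance. For $w\in V(G)$, $V_i(w)=\{v\in V(G)\setminus\{w\}: d(v,w)=i\}$. A vertex $w$ resolves $u,v$ if $d(u,w)\neq d(v,w)$. $V_p$ is the set of all unordered pairs of distinct vertices. For $(u,v)\in V_p$, $R(u,v)=\{x: x\text{ resolves } u,v\}$, and $r_w(u,v)=1/|R(u,v)|$ if $w$ resolves $u,v$, else $0$. -}

module Defs where

open import Data.Bool using (Bool; true; false; _∨_; _∧_; not; T; if_then_else_)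
open import Data.Nat using (ℕ; zero; suc; _⊔_; _≡ᵇ_)
open import Data.Fin using (Fin; _≟_)
open import Data.Bool.ListAction using (any)
open import Data.List using (List; allFin; filter; length; map; foldr; concatMap)
open import Data.Product using (_×_; ∃)
open import Relation.Nullary using (¬_; yes; no)
open import Relation.Nullary.Decidable using (⌊_⌋; ¬?)
open import Relation.Binary.PropositionalEquality using (_≡_; _≢_)
import Data.Nat as ℕ
open import Data.Integer using (+_)
open import Data.Rational using (ℚ; 0ℚ; _/_)

record Graph (n : ℕ) : Set where
  field
    adj    : Fin n → Fin n → Bool
    sym    : ∀ x y → adj x y ≡ adj y x
    irrefl : ∀ x → adj x x ≡ false
open Graph public

module _ {n : ℕ} (G : Graph n) where

  -- within k x y = true iff there is a walk from x to y of length at most k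
  within : ℕ → Fin n → Fin n → Bool
  within zero    x y = ⌊ x ≟ y ⌋
  within (suc k) x y = within k x y ∨ any (λ z → within k x z ∧ adj G z y) (allFin n)

  Connected : Set
  Connected = ∀ x y → ∃ λ k → T (within k x y)

  search : Fin n → Fin n → ℕ → ℕ → ℕ
  search x y k zero    = k
  search x y k (suc f) = if within k x y then k else search x y (suc k) f

  -- shortest-path distance d(x,y) (a shortest path in a connected graph
  -- on n vertices has length < n, so fuel n suffices)
  dist : Fin n → Fin n → ℕ
  dist x y = search x y 0 n

  diam : ℕ
  diam = foldr _⊔_ 0 (concatMap (λ x → map (λ y → dist x y) (allFin n)) (allFin n))

  InSphere : ℕ → Fin n → Fin n → Set
  InSphere i w v = v ≢ w × dist v w ≡ i

  Resolves : Fin n → Fin n → Fin n → Set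
  Resolves w u v = dist u w ≢ dist v w

  resolvingCount : Fin n → Fin n → ℕ
  resolvingCount u v = length (filter (λ x → ¬? (dist u x ℕ.≟ dist v x)) (allFin n))

  private
    recip : ℕ → ℚ
    recip zero    = 0ℚ
    recip (suc m) = + 1 / suc m

  r : Fin n → Fin n → Fin n → ℚ
  r w u v with dist u w ℕ.≟ dist v w
  ... | yes _ = 0ℚ
  ... | no  _ = recip (resolvingCount u v)

module Submission where

-- The proof is elementary once three general facts are available.
--   * Distance is symmetric.  Since dist is the least k with `within k x y`,
--     it suffices that `within k` is symmetric, which follows by reversing
--     walks: a walk of length ≤ k can be extended at either end by an edge.
--   * For x ≢ y, 1 ≤ dist x y ≤ diam G.
--   * r_w(u,v) = 0 exactly when d(u,w) = d(v,w): when w resolves u, v the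
--     count |R(u,v)| is positive (w itself is counted), so 1/|R(u,v)| ≠ 0.
-- Forward: a vertex x ∉ {u,v} is equidistant from u and v, so it lies in
-- V_i(u) iff it lies in V_i(v).  Backward: for w ∉ {u,v} put i = d(w,u);
-- then w ∈ V_i(u) ∖ {v} = V_i(v) ∖ {u}, hence d(w,v) = i = d(w,u).

open import Defs hiding (sym)
open import Data.Nat using (ℕ; zero; suc; _≤_; _⊔_; s≤s; z≤n)
import Data.Nat as ℕ
import Data.Nat.Properties as ℕP
open import Data.Fin using (Fin)
import Data.Fin as F
open import Data.Bool using (Bool; true; false; T; _∧_)
open import Data.Bool.Properties using (T-∨; T-∧; T-≡; ⇔→≡)
open import Data.List using (List; _∷_; allFin; foldr; map; length)
open import Data.List.Membership.Propositional using (_∈_)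
open import Data.List.Membership.Propositional.Properties
  using (∈-allFin; ∈-concatMap⁺; ∈-map⁺; ∈-filter⁺)
open import Data.List.Relation.Unary.Any using (here; there; satisfied)
import Data.List.Relation.Unary.Any as Any
open import Data.List.Relation.Unary.Any.Properties using (any⁺; any⁻)
open import Data.Product using (_×_; _,_; ∃)
open import Data.Empty using (⊥; ⊥-elim)
open import Data.Sum using (_⊎_; inj₁; inj₂)
open import Data.Rational using (0ℚ; Positive)
import Data.Rational.Properties as ℚP
open import Function.Bundles using (_⇔_; mk⇔; Equivalence)
open import Relation.Nullary using (Dec; yes; no)
open import Relation.Nullary.Decidable using (toWitness; fromWitness; ¬?)
open import Relation.Binary.PropositionalEquality
  using (_≡_; _≢_; refl; sym; subst; module ≡-Reasoning)

open Equivalence using (to; from)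

T-⇔⇒≡ : ∀ {a b : Bool} → (T a → T b) → (T b → T a) → a ≡ b
T-⇔⇒≡ a⇒b b⇒a = ⇔→≡ {z = true}
  (mk⇔ (λ a≡t → to T-≡ (a⇒b (from T-≡ a≡t))) (λ b≡t → to T-≡ (b⇒a (from T-≡ b≡t))))

≤-foldr-⊔ : ∀ {m} ms → m ∈ ms → m ≤ foldr _⊔_ 0 ms
≤-foldr-⊔ (k ∷ ks) (here refl) = ℕP.m≤m⊔n k _
≤-foldr-⊔ (k ∷ ks) (there m∈) = ℕP.≤-trans (≤-foldr-⊔ ks m∈) (ℕP.m≤n⊔m k _)

module _ {n : ℕ} (G : Graph n) where

  Walk≤ : ℕ → Fin n → Fin n → Set
  Walk≤ k x y = T (within G k x y)

  -- A walk of length 0 stays put.  (Indices are explicit below because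
  -- T ∘ within does not determine them.)
  walk≤-zero : ∀ x y → Walk≤ 0 x y → x ≡ y
  walk≤-zero x y = toWitness {a? = x F.≟ y}

  walk≤-refl : ∀ x → Walk≤ 0 x x
  walk≤-refl x = fromWitness {a? = x F.≟ x} refl

  walk≤-weaken : ∀ k x y → Walk≤ k x y → Walk≤ (suc k) x y
  walk≤-weaken k x y w = from (T-∨ {within G k x y}) (inj₁ w)

  walk≤-snoc : ∀ k x z y → Walk≤ k x z → T (adj G z y) → Walk≤ (suc k) x y
  walk≤-snoc k x z y w e = from (T-∨ {within G k x y}) (inj₂
    (any⁺ (λ z → within G k x z ∧ adj G z y)
          (Any.map (λ { refl → from T-∧ (w , e) }) (∈-allFin z))))

  walk≤-unsnoc : ∀ k x y → Walk≤ (suc k) x y →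
                 Walk≤ k x y ⊎ ∃ λ z → Walk≤ k x z × T (adj G z y)
  walk≤-unsnoc k x y w with to (T-∨ {within G k x y}) w
  ... | inj₁ short = inj₁ short
  ... | inj₂ viaEdge
    with satisfied (any⁻ (λ z → within G k x z ∧ adj G z y) (allFin n) viaEdge)
  ...   | z , w∧e = inj₂ (z , to (T-∧ {within G k x z}) w∧e)

  walk≤-cons : ∀ k x z y → T (adj G x z) → Walk≤ k z y → Walk≤ (suc k) x y
  walk≤-cons zero x z y e w with walk≤-zero z y w
  ... | refl = walk≤-snoc 0 x x z (walk≤-refl x) e
  walk≤-cons (suc k) x z y e w with walk≤-unsnoc k z y w
  ... | inj₁ short = walk≤-weaken (suc k) x y (walk≤-cons k x z y e short)
  ... | inj₂ (z' , w' , e') = walk≤-snoc (suc k) x z' y (walk≤-cons k x z z' e w') e'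

  walk≤-sym : ∀ k x y → Walk≤ k x y → Walk≤ k y x
  walk≤-sym zero x y w with walk≤-zero x y w
  ... | refl = w
  walk≤-sym (suc k) x y w with walk≤-unsnoc k x y w
  ... | inj₁ short = walk≤-weaken k y x (walk≤-sym k x y short)
  ... | inj₂ (z , w' , e) =
    walk≤-cons k y z x (subst T (Graph.sym G z y) e) (walk≤-sym k x z w')

  within-sym : ∀ k x y → within G k x y ≡ within G k y x
  within-sym k x y = T-⇔⇒≡ (walk≤-sym k x y) (walk≤-sym k y x)

  search-sym : ∀ x y k fuel → search G x y k fuel ≡ search G y x k fuel
  search-sym x y k zero = refl
  search-sym x y k (suc fuel)
    rewrite within-sym k x y | search-sym x y (suc k) fuel = refl

  dist-sym : ∀ x y → dist G x y ≡ dist G y x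
  dist-sym x y = search-sym x y 0 n

  search-≥ : ∀ x y k fuel → k ≤ search G x y k fuel
  search-≥ x y k zero = ℕP.≤-refl
  search-≥ x y k (suc fuel) with within G k x y
  ... | true  = ℕP.≤-refl
  ... | false = ℕP.≤-trans (ℕP.n≤1+n k) (search-≥ x y (suc k) fuel)

  dist≤diam : ∀ x y → dist G x y ≤ diam G
  dist≤diam x y = ≤-foldr-⊔ _ (∈-concatMap⁺ (λ x → map (dist G x) (allFin n))
    (Any.map (λ { refl → ∈-map⁺ (dist G x) (∈-allFin y) }) (∈-allFin x)))

  resolvingCount-pos : ∀ {w u v} → Resolves G w u v → 1 ≤ resolvingCount G u v
  resolvingCount-pos {w} {u} {v} resolves =
    nonempty (∈-filter⁺ decide (∈-allFin w) resolves)
    where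
    decide : ∀ x → Dec (Resolves G x u v)
    decide x = ¬? (dist G u x ℕ.≟ dist G v x)
    nonempty : ∀ {xs : List (Fin n)} → w ∈ xs → 1 ≤ length xs
    nonempty {_ ∷ _} _ = s≤s z≤n

  r≡0⇔equidistant : ∀ w u v → r G w u v ≡ 0ℚ ⇔ dist G u w ≡ dist G v w
  r≡0⇔equidistant w u v = mk⇔ r≡0⇒equidistant equidistant⇒r≡0
    where
    r≡0⇒equidistant : r G w u v ≡ 0ℚ → dist G u w ≡ dist G v w
    r≡0⇒equidistant r≡0 with dist G u w ℕ.≟ dist G v w
    ... | yes same = same
    ... | no resolves with resolvingCount G u v | resolvingCount-pos {w} resolves
    ...   | suc m | _ =
      ⊥-elim (0ℚ-not-positive (subst Positive r≡0 (ℚP.normalize-pos 1 (suc m))))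
      where
      0ℚ-not-positive : Positive 0ℚ → ⊥
      0ℚ-not-positive ()
    equidistant⇒r≡0 : dist G u w ≡ dist G v w → r G w u v ≡ 0ℚ
    equidistant⇒r≡0 same with dist G u w ℕ.≟ dist G v w
    ... | yes _       = refl
    ... | no resolves = ⊥-elim (resolves same)

-- Distinct vertices are at distance at least 1: there is no walk of length 0.
dist-pos : ∀ {n} (G : Graph n) {x y : Fin n} → x ≢ y → 1 ≤ dist G x y
dist-pos {suc m} G {x} {y} x≢y with x F.≟ y
... | yes x≡y = ⊥-elim (x≢y x≡y)
... | no _    = search-≥ G x y 1 m

module _ {n : ℕ} (G : Graph n) (u v : Fin n) where

  UnresolvedOutside : Set
  UnresolvedOutside = ∀ w → w ≢ u → w ≢ v → r G w u v ≡ 0ℚ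

  SameSpheres : Set
  SameSpheres = ∀ i → 1 ≤ i → i ≤ diam G → ∀ x →
    ((InSphere G i u x × x ≢ v) ⇔ (InSphere G i v x × x ≢ u))

sphere-transfer : ∀ {n} (G : Graph n) {u v x : Fin n} {i : ℕ} →
  dist G u x ≡ dist G v x →
  InSphere G i u x × x ≢ v → InSphere G i v x × x ≢ u
sphere-transfer G {u} {v} {x} {i} same ((x≢u , xu≡i) , x≢v) = (x≢v , xv≡i) , x≢u
  where
  open ≡-Reasoning
  xv≡i : dist G x v ≡ i
  xv≡i = begin
    dist G x v ≡⟨ dist-sym G x v ⟩
    dist G v x ≡⟨ sym same ⟩
    dist G u x ≡⟨ dist-sym G u x ⟩
    dist G x u ≡⟨ xu≡i ⟩
    i          ∎

unresolved⇒sameSpheres : ∀ {n} (G : Graph n) (u v : Fin n) →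
  UnresolvedOutside G u v → SameSpheres G u v
unresolved⇒sameSpheres G u v unresolved i _ _ x = mk⇔
  (λ p@((x≢u , _) , x≢v) → sphere-transfer G (equidistant x≢u x≢v) p)
  (λ p@((x≢v , _) , x≢u) → sphere-transfer G (sym (equidistant x≢u x≢v)) p)
  where
  equidistant : x ≢ u → x ≢ v → dist G u x ≡ dist G v x
  equidistant x≢u x≢v = to (r≡0⇔equidistant G x u v) (unresolved x x≢u x≢v)

sameSpheres⇒unresolved : ∀ {n} (G : Graph n) (u v : Fin n) →
  SameSpheres G u v → UnresolvedOutside G u v
sameSpheres⇒unresolved G u v spheres w w≢u w≢v =
  from (r≡0⇔equidistant G w u v) (begin
    dist G u w ≡⟨ dist-sym G u w ⟩
    dist G w u ≡⟨ sym wv≡wu ⟩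
    dist G w v ≡⟨ dist-sym G w v ⟩
    dist G v w ∎)
  where
  open ≡-Reasoning
  i : ℕ
  i = dist G w u
  wv≡wu : dist G w v ≡ i
  wv≡wu with to (spheres i (dist-pos G w≢u) (dist≤diam G w u) w) ((w≢u , refl) , w≢v)
  ... | (_ , wv≡i) , _ = wv≡i

-- Lemma 2.4.
lemma2p4 : ∀ {n : ℕ} (G : Graph n) → 2 ≤ n → Connected G →
    (u v : Fin n) → u ≢ v →
    ((∀ (w : Fin n) → w ≢ u → w ≢ v → r G w u v ≡ 0ℚ)
      ⇔ (∀ (i : ℕ) → 1 ≤ i → i ≤ diam G → ∀ (x : Fin n) →
           ((InSphere G i u x × x ≢ v) ⇔ (InSphere G i v x × x ≢ u))))
lemma2p4 G _ _ u v _ =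
  mk⇔ (unresolved⇒sameSpheres G u v) (sameSpheres⇒unresolved G u v)
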